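{- Let $h(x)$ be a polynomial with real coefficients and let $F_{h,n}(x)$ be defined by $F_{h,0}=0$, $F_{h,1}=1$, $F_{h,n+1}=h(x)F_{h,n}+F_{h,n-1}$ ($n\ge1$). Fix an integer $l\ge0$ and set $F_{h,n}^l(x)=\sum_{i=0}^{l}\binom{n-1-i}{i}h^{n-2i-1}(x)$ for $n\ge 2l+1$ and $F_{h,n}^l(x)=0$ for $0\le n<2l+1$. Then, as formal power series in $t$, $$\sum_{i=0}^{\infty}F_{h,i}^{l}(x)\,t^{i}=\frac{t^{2l+1}\left[F_{h,2l+1}(x)+\big(F_{h,2l+2}(x)-h(x)F_{h,2l+1}(x)\big)t-\dfrac{t^{2}}{(1-h(x)t)^{l+1}}\right]}{1-h(x)t-t^{2}}.$$
   Context: $h(x)$ is a polynomial with real coefficients. $F_{h,n}$ are the $h(x)$-Fibonacci polynomials and $F^l_{h,n}$ the incomplete $h(x)$-Fibonacci polynomials (extended by $0$ for $n<2l+1$). -}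

module Defs where

open import Level using (Level)
open import Data.Nat as ℕ using (ℕ; zero; suc; _∸_; _<ᵇ_)
open import Data.Nat.Combinatorics using (_C_)
open import Data.Bool using (if_then_else_)
open import Algebra.Bundles using (CommutativeRing; Semiring)

-- Formal power series in t over an arbitrary commutative ring R
-- (the paper uses R = ℝ[x]), represented by coefficient
-- functions ℕ → R.
module FPS {c ℓ : Level} (R : CommutativeRing c ℓ) where
  open CommutativeRing R public
  open import Algebra.Definitions.RawSemiring (Semiring.rawSemiring semiring) public using (_×_; _^_)

  Series : Set c
  Series = ℕ → Carrier

  infix 4 _≋_
  _≋_ : Series → Series → Set ℓ
  f ≋ g = ∀ n → f n ≈ g n

  sumTo : ℕ → (ℕ → Carrier) → Carrier
  sumTo zero    f = f 0
  sumTo (suc n) f = sumTo n f + f (suc n)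

  const : Carrier → Series
  const a zero    = a
  const a (suc n) = 0#

  tpow : ℕ → Series
  tpow zero    zero    = 1#
  tpow zero    (suc n) = 0#
  tpow (suc m) zero    = 0#
  tpow (suc m) (suc n) = tpow m n

  infixl 6 _⊕_ _⊖_
  infixl 7 _⊛_ _⊘_
  _⊕_ : Series → Series → Series
  (f ⊕ g) n = f n + g n

  ⊝_ : Series → Series
  (⊝ f) n = - (f n)

  _⊖_ : Series → Series → Series
  f ⊖ g = f ⊕ (⊝ g)

  _⊛_ : Series → Series → Series
  (f ⊛ g) n = sumTo n (λ k → f k * g (n ∸ k))

  _⊛^_ : Series → ℕ → Series
  f ⊛^ zero  = const 1#
  f ⊛^ suc k = f ⊛ (f ⊛^ k)

  -- Multiplicative inverse of a series g with constant term 1: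
  -- writing g = 1 - u (u has zero constant term), g⁻¹ = Σ_k u^k,
  -- whose n-th coefficient is the finite sum Σ_{k=0}^{n} [t^n] u^k.
  inv : Series → Series
  inv g n = sumTo n (λ k → (u ⊛^ k) n)
    where
    u : Series
    u zero    = 0#
    u (suc m) = - (g (suc m))

  -- f / g  (meaningful when g has constant term 1)
  _⊘_ : Series → Series → Series
  f ⊘ g = f ⊛ inv g

  Fib : Carrier → ℕ → Carrier
  Fib h zero          = 0#
  Fib h (suc zero)    = 1#
  Fib h (suc (suc n)) = h * Fib h (suc n) + Fib h n

  IncFib : Carrier → ℕ → ℕ → Carrier
  IncFib h l n =
    if n <ᵇ suc (2 ℕ.* l) then 0#
    else sumTo l (λ i → ((n ∸ 1 ∸ i) C i) × (h ^ (n ∸ 2 ℕ.* i ∸ 1)))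

-- Write F^l_n for the sum Σ_{i≤l} C(n-1-i,i) h^(n-2i-1) without the cutoff. Pascal's rule
-- gives F^l_{n+2} = h F^l_{n+1} + F^(l-1)_n, so these sums obey the Fibonacci recurrence
-- except for the top term C(n-1-l,l) h^(n-2l-1) of F^l_n. Hence X = Σ_m F^l_{2l+1+m} t^m
-- satisfies (1 - ht - t²) X = F_{2l+1} + (F_{2l+2} - h F_{2l+1}) t - t² Σ_m C(m+l,l) h^m t^m,
-- and the last sum is the negative binomial series 1/(1 - ht)^(l+1).
module Submission where

open import Level using (Level)
open import Algebra.Bundles using (CommutativeRing)
open import Data.Bool using (true; false; if_then_else_; T)
open import Data.Nat as ℕ using (ℕ; zero; suc; _∸_; _<ᵇ_; z≤n; s≤s)
import Data.Nat.Properties as ℕₚ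
open import Data.Nat.Combinatorics using (_C_; nCk+nC[k+1]≡[n+1]C[k+1]; nCn≡1; k>n⇒nCk≡0)
open import Data.Sum using (inj₁; inj₂)
open import Relation.Binary.Bundles using (Setoid)
open import Relation.Binary.PropositionalEquality as ≡ using (_≡_)
open import Defs

[1+m]∸n∸1≡m∸n : ∀ m n → suc m ∸ n ∸ 1 ≡ m ∸ n
[1+m]∸n∸1≡m∸n m n = ≡.trans (ℕₚ.∸-+-assoc (suc m) n 1) (≡.cong (suc m ∸_) (ℕₚ.+-comm n 1))

[2+m]∸2*[1+n]≡m∸2*n : ∀ m n → suc (suc m) ∸ 2 ℕ.* suc n ≡ m ∸ 2 ℕ.* n
[2+m]∸2*[1+n]≡m∸2*n m n = ≡.cong (suc (suc m) ∸_) (ℕₚ.*-suc 2 n)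

m+2*n∸n≡m+n : ∀ m n → m ℕ.+ 2 ℕ.* n ∸ n ≡ m ℕ.+ n
m+2*n∸n≡m+n m n = ≡.trans (≡.cong (_∸ n) m+2*n≡m+n+n) (ℕₚ.m+n∸n≡m (m ℕ.+ n) n)
  where
  m+2*n≡m+n+n : m ℕ.+ 2 ℕ.* n ≡ m ℕ.+ n ℕ.+ n
  m+2*n≡m+n+n = ≡.trans (≡.cong (λ k → m ℕ.+ (n ℕ.+ k)) (ℕₚ.+-identityʳ n)) (≡.sym (ℕₚ.+-assoc m n n))

[1+m]C[1+n]≡[1+[m∸n]]C[1+n] : ∀ m n → (suc m ∸ n) C suc n ≡ suc (m ∸ n) C suc n
[1+m]C[1+n]≡[1+[m∸n]]C[1+n] m n with ℕₚ.≤-<-connex n m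
... | inj₁ n≤m = ≡.cong (_C suc n) (ℕₚ.+-∸-assoc 1 n≤m)
... | inj₂ m<n = ≡.trans (k>n⇒nCk≡0 (s≤s (ℕₚ.≤-trans (ℕₚ.m∸n≤m (suc m) n) m<n)))
                         (≡.sym (k>n⇒nCk≡0 (s≤s (ℕₚ.≤-<-trans (ℕₚ.m∸n≤m m n) m<n))))

module PowerSeries {c ℓ : Level} (R : CommutativeRing c ℓ) where
  open FPS R
  open import Relation.Binary.Reasoning.Setoid setoid
  open import Algebra.Properties.Ring ring using (-‿distribˡ-*)
  open import Algebra.Properties.AbelianGroup +-abelianGroup using (⁻¹-∙-comm)
  open import Algebra.Properties.Group +-group using (ε⁻¹≈ε; ⁻¹-involutive; //-rightDividesʳ)
  open import Algebra.Properties.CommutativeSemigroup +-commutativeSemigroup using (interchange; x∙yz≈y∙xz)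

  sumTo-cong≤ : ∀ n {f g : ℕ → Carrier} → (∀ i → i ℕ.≤ n → f i ≈ g i) → sumTo n f ≈ sumTo n g
  sumTo-cong≤ zero    f≈g = f≈g 0 z≤n
  sumTo-cong≤ (suc n) f≈g =
    +-cong (sumTo-cong≤ n (λ i i≤n → f≈g i (ℕₚ.m≤n⇒m≤1+n i≤n))) (f≈g (suc n) ℕₚ.≤-refl)

  sumTo-cong : ∀ n {f g : ℕ → Carrier} → (∀ i → f i ≈ g i) → sumTo n f ≈ sumTo n g
  sumTo-cong n f≈g = sumTo-cong≤ n (λ i _ → f≈g i)

  sumTo-zero : ∀ n {f : ℕ → Carrier} → (∀ i → i ℕ.≤ n → f i ≈ 0#) → sumTo n f ≈ 0#
  sumTo-zero zero    f≈0 = f≈0 0 z≤n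
  sumTo-zero (suc n) f≈0 = trans
    (+-cong (sumTo-zero n (λ i i≤n → f≈0 i (ℕₚ.m≤n⇒m≤1+n i≤n))) (f≈0 (suc n) ℕₚ.≤-refl))
    (+-identityʳ 0#)

  sumTo-distrib-+ : ∀ n (f g : ℕ → Carrier) → sumTo n (λ i → f i + g i) ≈ sumTo n f + sumTo n g
  sumTo-distrib-+ zero    f g = refl
  sumTo-distrib-+ (suc n) f g = trans (+-congʳ (sumTo-distrib-+ n f g)) (interchange _ _ _ _)

  *-distribˡ-sumTo : ∀ n x (f : ℕ → Carrier) → x * sumTo n f ≈ sumTo n (λ i → x * f i)
  *-distribˡ-sumTo zero    x f = refl
  *-distribˡ-sumTo (suc n) x f = trans (distribˡ x _ _) (+-congʳ (*-distribˡ-sumTo n x f))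

  -‿distrib-sumTo : ∀ n (f : ℕ → Carrier) → - sumTo n f ≈ sumTo n (λ i → - f i)
  -‿distrib-sumTo zero    f = refl
  -‿distrib-sumTo (suc n) f = trans (sym (⁻¹-∙-comm _ _)) (+-congʳ (-‿distrib-sumTo n f))

  sumTo-suc : ∀ n (f : ℕ → Carrier) → sumTo (suc n) f ≈ f 0 + sumTo n (λ i → f (suc i))
  sumTo-suc zero    f = refl
  sumTo-suc (suc n) f = trans (+-congʳ (sumTo-suc n f)) (+-assoc _ _ _)

  sumTo-comm : ∀ m n (f : ℕ → ℕ → Carrier) →
               sumTo m (λ i → sumTo n (f i)) ≈ sumTo n (λ j → sumTo m (λ i → f i j))
  sumTo-comm m zero    f = refl
  sumTo-comm m (suc n) f = trans (sumTo-distrib-+ m _ _) (+-congʳ (sumTo-comm m n f))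

  y-x≈y : ∀ {x} y → x ≈ 0# → y - x ≈ y
  y-x≈y y x≈0 = trans (+-congˡ (trans (-‿cong x≈0) ε⁻¹≈ε)) (+-identityʳ y)

  ≋-setoid : Setoid c ℓ
  ≋-setoid = record
    { Carrier       = Series
    ; _≈_           = _≋_
    ; isEquivalence = record
      { refl  = λ _ → refl
      ; sym   = λ f≋g n → sym (f≋g n)
      ; trans = λ f≋g g≋w n → trans (f≋g n) (g≋w n)
      }
    }

  module ≋ = Setoid ≋-setoid

  shift : Series → Series
  shift f n = f (suc n)

  scale : Carrier → Series → Series
  scale a f n = a * f n

  ⊛-suc : ∀ f g n → (f ⊛ g) (suc n) ≈ f 0 * g (suc n) + (shift f ⊛ g) n
  ⊛-suc f g n = sumTo-suc n _

  ⊛-cong≤ : ∀ n {f f′ g g′} → (∀ i → i ℕ.≤ n → f i ≈ f′ i) → (∀ i → i ℕ.≤ n → g i ≈ g′ i) →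
            (f ⊛ g) n ≈ (f′ ⊛ g′) n
  ⊛-cong≤ n f≈f′ g≈g′ =
    sumTo-cong≤ n (λ i i≤n → *-cong (f≈f′ i i≤n) (g≈g′ (n ∸ i) (ℕₚ.m∸n≤m n i)))

  ⊛-cong : ∀ {f f′ g g′} → f ≋ f′ → g ≋ g′ → f ⊛ g ≋ f′ ⊛ g′
  ⊛-cong f≋f′ g≋g′ n = ⊛-cong≤ n (λ i _ → f≋f′ i) (λ i _ → g≋g′ i)

  ⊛-congˡ : ∀ f {g g′} → g ≋ g′ → f ⊛ g ≋ f ⊛ g′
  ⊛-congˡ f = ⊛-cong {f} {f} ≋.refl

  ⊛-congʳ : ∀ g {f f′} → f ≋ f′ → f ⊛ g ≋ f′ ⊛ g
  ⊛-congʳ g f≋f′ = ⊛-cong {g = g} {g} f≋f′ ≋.refl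

  ⊛^-cong : ∀ {f f′} → f ≋ f′ → ∀ k → f ⊛^ k ≋ f′ ⊛^ k
  ⊛^-cong f≋f′ zero    = ≋.refl
  ⊛^-cong f≋f′ (suc k) = ⊛-cong f≋f′ (⊛^-cong f≋f′ k)

  ⊛-distribʳ : ∀ f g w → (f ⊕ g) ⊛ w ≋ f ⊛ w ⊕ g ⊛ w
  ⊛-distribʳ f g w n = trans (sumTo-cong n (λ i → distribʳ _ _ _)) (sumTo-distrib-+ n _ _)

  ⊛-distribˡ-sumTo : ∀ m f (w : ℕ → Series) →
                     f ⊛ (λ j → sumTo m (λ k → w k j)) ≋ (λ n → sumTo m (λ k → (f ⊛ w k) n))
  ⊛-distribˡ-sumTo m f w n =
    trans (sumTo-cong n (λ i → *-distribˡ-sumTo m (f i) _)) (sumTo-comm n m _)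

  -‿distribˡ-⊛ : ∀ f g → (⊝ f) ⊛ g ≋ ⊝ (f ⊛ g)
  -‿distribˡ-⊛ f g n =
    trans (sumTo-cong n (λ i → sym (-‿distribˡ-* _ _))) (sym (-‿distrib-sumTo n _))

  scale-⊛ : ∀ a f g → scale a f ⊛ g ≋ scale a (f ⊛ g)
  scale-⊛ a f g n = trans (sumTo-cong n (λ i → *-assoc _ _ _)) (sym (*-distribˡ-sumTo n a _))

  const-⊛ : ∀ a g → const a ⊛ g ≋ scale a g
  const-⊛ a g zero    = refl
  const-⊛ a g (suc n) = trans (⊛-suc (const a) g n)
    (trans (+-congˡ (sumTo-zero n (λ i _ → zeroˡ _))) (+-identityʳ _))

  ⊛-identityˡ : ∀ f → const 1# ⊛ f ≋ f
  ⊛-identityˡ f n = trans (const-⊛ 1# f n) (*-identityˡ _)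

  ⊛-comm : ∀ f g → f ⊛ g ≋ g ⊛ f
  ⊛-comm f g zero          = *-comm _ _
  ⊛-comm f g (suc zero)    = begin
    f 0 * g 1 + f 1 * g 0 ≈⟨ +-comm _ _ ⟩
    f 1 * g 0 + f 0 * g 1 ≈⟨ +-cong (*-comm _ _) (*-comm _ _) ⟩
    g 0 * f 1 + g 1 * f 0 ∎
  ⊛-comm f g (suc (suc m)) = begin
    (f ⊛ g) (2 ℕ.+ m)                                  ≈⟨ ⊛-suc f g (suc m) ⟩
    a + (shift f ⊛ g) (suc m)                          ≈⟨ +-congˡ (⊛-comm (shift f) g (suc m)) ⟩
    a + (g ⊛ shift f) (suc m)                          ≈⟨ +-congˡ (⊛-suc g (shift f) m) ⟩
    a + (b + (shift g ⊛ shift f) m)                    ≈⟨ x∙yz≈y∙xz a b _ ⟩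
    b + (a + (shift g ⊛ shift f) m)                    ≈⟨ +-congˡ (+-congˡ (⊛-comm (shift g) (shift f) m)) ⟩
    b + (a + (shift f ⊛ shift g) m)                    ≈⟨ +-congˡ (⊛-suc f (shift g) m) ⟨
    b + (f ⊛ shift g) (suc m)                          ≈⟨ +-congˡ (⊛-comm f (shift g) (suc m)) ⟩
    b + (shift g ⊛ f) (suc m)                          ≈⟨ ⊛-suc g f (suc m) ⟨
    (g ⊛ f) (2 ℕ.+ m)                                  ∎
    where
    a = f 0 * g (2 ℕ.+ m)
    b = g 0 * f (2 ℕ.+ m)

  ⊛-identityʳ : ∀ f → f ⊛ const 1# ≋ f
  ⊛-identityʳ f = ≋.trans (⊛-comm f (const 1#)) (⊛-identityˡ f)

  ⊛-assoc : ∀ f g w → (f ⊛ g) ⊛ w ≋ f ⊛ (g ⊛ w)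
  ⊛-assoc f g w zero    = *-assoc _ _ _
  ⊛-assoc f g w (suc n) = begin
    ((f ⊛ g) ⊛ w) (suc n)                                             ≈⟨ ⊛-suc (f ⊛ g) w n ⟩
    (f 0 * g 0) * w (suc n) + (shift (f ⊛ g) ⊛ w) n
      ≈⟨ +-cong (*-assoc _ _ _) (⊛-congʳ w (⊛-suc f g) n) ⟩
    f 0 * (g 0 * w (suc n)) + ((scale (f 0) (shift g) ⊕ shift f ⊛ g) ⊛ w) n
      ≈⟨ +-congˡ (⊛-distribʳ (scale (f 0) (shift g)) (shift f ⊛ g) w n) ⟩
    f 0 * (g 0 * w (suc n)) + ((scale (f 0) (shift g) ⊛ w) n + ((shift f ⊛ g) ⊛ w) n)
      ≈⟨ +-congˡ (+-cong (scale-⊛ (f 0) (shift g) w n) (⊛-assoc (shift f) g w n)) ⟩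
    f 0 * (g 0 * w (suc n)) + (f 0 * (shift g ⊛ w) n + (shift f ⊛ (g ⊛ w)) n)
      ≈⟨ +-assoc _ _ _ ⟨
    (f 0 * (g 0 * w (suc n)) + f 0 * (shift g ⊛ w) n) + (shift f ⊛ (g ⊛ w)) n
      ≈⟨ +-congʳ (trans (*-congˡ (⊛-suc g w n)) (distribˡ _ _ _)) ⟨
    f 0 * (g ⊛ w) (suc n) + (shift f ⊛ (g ⊛ w)) n                      ≈⟨ ⊛-suc f (g ⊛ w) n ⟨
    (f ⊛ (g ⊛ w)) (suc n)                                             ∎

  tpow-⊛ : ∀ k f n → (tpow k ⊛ f) n ≈ (if n <ᵇ k then 0# else f (n ∸ k))
  tpow-⊛ zero    f zero    = *-identityˡ _
  tpow-⊛ zero    f (suc n) = trans (⊛-suc (tpow 0) f n)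
    (trans (+-cong (*-identityˡ _) (sumTo-zero n (λ i _ → zeroˡ _))) (+-identityʳ _))
  tpow-⊛ (suc k) f zero    = zeroˡ _
  tpow-⊛ (suc k) f (suc n) = trans (⊛-suc (tpow (suc k)) f n)
    (trans (+-cong (zeroˡ _) (tpow-⊛ k f n)) (+-identityˡ _))

  ⊛^-constantTerm : ∀ {f} → f 0 ≈ 1# → ∀ k → (f ⊛^ k) 0 ≈ 1#
  ⊛^-constantTerm f₀≈1 zero    = refl
  ⊛^-constantTerm f₀≈1 (suc k) = trans (*-cong f₀≈1 (⊛^-constantTerm f₀≈1 k)) (*-identityˡ 1#)

  -- Σ_k u^k, truncated at the n-th coefficient, which is exact when u has no constant term
  geometric : Series → Series
  geometric u n = sumTo n (λ k → (u ⊛^ k) n)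

  module _ {u : Series} (u₀≈0 : u 0 ≈ 0#) where

    private
      u₀*≈0 : ∀ x → u 0 * x ≈ 0#
      u₀*≈0 x = trans (*-congʳ u₀≈0) (zeroˡ x)

    ⊛^-vanishes : ∀ k n → n ℕ.< k → (u ⊛^ k) n ≈ 0#
    ⊛^-vanishes (suc k) zero    _         = u₀*≈0 _
    ⊛^-vanishes (suc k) (suc n) (s≤s n<k) = trans (⊛-suc u (u ⊛^ k) n)
      (trans (+-cong (u₀*≈0 _) (sumTo-zero n (λ i _ → trans
               (*-congˡ (⊛^-vanishes k (n ∸ i) (ℕₚ.≤-<-trans (ℕₚ.m∸n≤m n i) n<k))) (zeroʳ _))))
             (+-identityˡ 0#))

    sumTo-⊛^-stable : ∀ m n → n ℕ.≤ m → sumTo m (λ k → (u ⊛^ k) n) ≈ geometric u n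
    sumTo-⊛^-stable zero    zero z≤n = refl
    sumTo-⊛^-stable (suc m) n n≤1+m with ℕₚ.m≤n⇒m<n∨m≡n n≤1+m
    ... | inj₁ (s≤s n≤m) =
      trans (+-cong (sumTo-⊛^-stable m n n≤m) (⊛^-vanishes (suc m) n (s≤s n≤m))) (+-identityʳ _)
    ... | inj₂ ≡.refl   = refl

    geometric-unfold : geometric u ≋ const 1# ⊕ u ⊛ geometric u
    geometric-unfold zero    = trans (sym (+-identityʳ 1#)) (+-congˡ (sym (u₀*≈0 _)))
    geometric-unfold (suc m) = begin
      geometric u (suc m)                               ≈⟨ sumTo-suc m (λ k → (u ⊛^ k) (suc m)) ⟩
      0# + sumTo m (λ k → (u ⊛ (u ⊛^ k)) (suc m))        ≈⟨ +-identityˡ _ ⟩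
      sumTo m (λ k → (u ⊛ (u ⊛^ k)) (suc m))             ≈⟨ ⊛-distribˡ-sumTo m u (u ⊛^_) (suc m) ⟨
      (u ⊛ partial) (suc m)                             ≈⟨ ⊛-suc u partial m ⟩
      u 0 * partial (suc m) + (shift u ⊛ partial) m
        ≈⟨ +-cong (trans (u₀*≈0 _) (sym (u₀*≈0 _))) (⊛-cong≤ m (λ _ _ → refl) (sumTo-⊛^-stable m)) ⟩
      u 0 * geometric u (suc m) + (shift u ⊛ geometric u) m ≈⟨ ⊛-suc u (geometric u) m ⟨
      (u ⊛ geometric u) (suc m)                         ≈⟨ +-identityˡ _ ⟨
      0# + (u ⊛ geometric u) (suc m)                    ∎
      where
      partial : Series
      partial j = sumTo m (λ k → (u ⊛^ k) j)

    geometric-inverse : (const 1# ⊖ u) ⊛ geometric u ≋ const 1#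
    geometric-inverse n = begin
      ((const 1# ⊖ u) ⊛ geometric u) n             ≈⟨ ⊛-distribʳ (const 1#) (⊝ u) (geometric u) n ⟩
      (const 1# ⊛ geometric u) n + ((⊝ u) ⊛ geometric u) n
        ≈⟨ +-cong (⊛-identityˡ (geometric u) n) (-‿distribˡ-⊛ u (geometric u) n) ⟩
      geometric u n - (u ⊛ geometric u) n          ≈⟨ +-congʳ (geometric-unfold n) ⟩
      (const 1# n + (u ⊛ geometric u) n) - (u ⊛ geometric u) n ≈⟨ //-rightDividesʳ _ _ ⟩
      const 1# n                                   ∎

  -- writing g = 1 - u, this is the u of the definition of inv
  negTail : Series → Series
  negTail g zero    = 0#
  negTail g (suc n) = - g (suc n)

  inv≋geometric : ∀ g → inv g ≋ geometric (negTail g)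
  inv≋geometric g n = sumTo-cong n (λ k → ⊛^-cong (λ { zero → refl ; (suc m) → refl }) k n)

  ≋1-negTail : ∀ {g} → g 0 ≈ 1# → g ≋ const 1# ⊖ negTail g
  ≋1-negTail g₀≈1 zero    = trans g₀≈1 (sym (y-x≈y 1# refl))
  ≋1-negTail g₀≈1 (suc m) = sym (trans (+-identityˡ _) (⁻¹-involutive _))

  ⊛-inverseʳ : ∀ {g} → g 0 ≈ 1# → g ⊛ inv g ≋ const 1#
  ⊛-inverseʳ {g} g₀≈1 =
    ≋.trans (⊛-cong (≋1-negTail g₀≈1) (inv≋geometric g)) (geometric-inverse refl)

  ⊘-unique : ∀ {f g x} → g 0 ≈ 1# → x ⊛ g ≋ f → x ≋ f ⊘ g
  ⊘-unique {g = g} {x} g₀≈1 x⊛g≋f =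
    ≋.trans (≋.sym (⊛-identityʳ x))
    (≋.trans (⊛-congˡ x (≋.sym (⊛-inverseʳ g₀≈1)))
    (≋.trans (≋.sym (⊛-assoc x g (inv g)))
             (⊛-congʳ (inv g) x⊛g≋f)))

module IncompleteFibonacci {c ℓ : Level} (R : CommutativeRing c ℓ) (h : CommutativeRing.Carrier R) where
  open FPS R
  open PowerSeries R
  open import Relation.Binary.Reasoning.Setoid setoid
  open import Algebra.Properties.AbelianGroup +-abelianGroup using (xyx⁻¹≈y)
  open import Algebra.Properties.Group +-group using (inverseˡ-unique)
  open import Algebra.Properties.CommutativeSemigroup +-commutativeSemigroup using (xy∙z≈xz∙y)
  open import Algebra.Properties.Monoid.Mult +-monoid using (×-congˡ; ×-homo-+)
  open import Algebra.Properties.Semiring.Mult semiring using (×-comm-*)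

  term : ℕ → ℕ → Carrier
  term n i = ((n ∸ 1 ∸ i) C i) × h ^ (n ∸ 2 ℕ.* i ∸ 1)

  incFibSum : ℕ → ℕ → Carrier
  incFibSum l n = sumTo l (term n)

  ×-pascal : ∀ n k e → (e ≡ 0 → n C suc k ≡ 0) →
             (suc n C suc k) × h ^ e ≈ h * ((n C suc k) × h ^ (e ∸ 1)) + (n C k) × h ^ e
  ×-pascal n k e e≡0⇒nC[1+k]≡0 = begin
    (suc n C suc k) × h ^ e                       ≈⟨ ×-congˡ (nCk+nC[k+1]≡[n+1]C[k+1] n k) ⟨
    (n C k ℕ.+ n C suc k) × h ^ e                 ≈⟨ ×-homo-+ (h ^ e) (n C k) (n C suc k) ⟩
    (n C k) × h ^ e + (n C suc k) × h ^ e         ≈⟨ +-comm _ _ ⟩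
    (n C suc k) × h ^ e + (n C k) × h ^ e         ≈⟨ +-congʳ (lower e e≡0⇒nC[1+k]≡0) ⟩
    h * ((n C suc k) × h ^ (e ∸ 1)) + (n C k) × h ^ e ∎
    where
    lower : ∀ e → (e ≡ 0 → n C suc k ≡ 0) → (n C suc k) × h ^ e ≈ h * ((n C suc k) × h ^ (e ∸ 1))
    lower zero    nC[1+k]≡0 =
      trans (×-congˡ (nC[1+k]≡0 ≡.refl)) (sym (trans (*-congˡ (×-congˡ (nC[1+k]≡0 ≡.refl))) (zeroʳ h)))
    lower (suc e) _         = sym (×-comm-* (n C suc k) h (h ^ e))

  term-0 : ∀ n → term (suc n) 0 ≈ h ^ n
  term-0 n = +-identityʳ _

  term-pascal : ∀ m i → term (3 ℕ.+ m) (suc i) ≈ h * term (2 ℕ.+ m) (suc i) + term (1 ℕ.+ m) i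
  term-pascal m i = begin
    term (3 ℕ.+ m) (suc i)
      ≡⟨ ≡.cong₂ (λ b e → b × h ^ e) ([1+m]C[1+n]≡[1+[m∸n]]C[1+n] m i)
                 (≡.trans (≡.cong (_∸ 1) ([2+m]∸2*[1+n]≡m∸2*n (suc m) i)) e₁) ⟩
    (suc (m ∸ i) C suc i) × h ^ (m ∸ 2 ℕ.* i)
      ≈⟨ ×-pascal (m ∸ i) i (m ∸ 2 ℕ.* i) (λ e≡0 → k>n⇒nCk≡0 (s≤s (m∸i≤i e≡0))) ⟩
    h * (((m ∸ i) C suc i) × h ^ (m ∸ 2 ℕ.* i ∸ 1)) + ((m ∸ i) C i) × h ^ (m ∸ 2 ℕ.* i)
      ≡⟨ ≡.cong₂ (λ e₂ e₃ → h * (((m ∸ i) C suc i) × h ^ e₂) + ((m ∸ i) C i) × h ^ e₃)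
                 (≡.cong (_∸ 1) ([2+m]∸2*[1+n]≡m∸2*n m i)) e₁ ⟨
    h * term (2 ℕ.+ m) (suc i) + term (1 ℕ.+ m) i ∎
    where
    e₁ : suc m ∸ 2 ℕ.* i ∸ 1 ≡ m ∸ 2 ℕ.* i
    e₁ = [1+m]∸n∸1≡m∸n m (2 ℕ.* i)
    m∸i≤i : m ∸ 2 ℕ.* i ≡ 0 → m ∸ i ℕ.≤ i
    m∸i≤i eq = ≡.subst (m ∸ i ℕ.≤_) (≡.trans (ℕₚ.m+n∸m≡n i (i ℕ.+ 0)) (ℕₚ.+-identityʳ i))
                 (ℕₚ.∸-monoˡ-≤ i (ℕₚ.m∸n≡0⇒m≤n eq))

  incFibSum-recurrence : ∀ L m →
    incFibSum (suc L) (3 ℕ.+ m) ≈ h * incFibSum (suc L) (2 ℕ.+ m) + incFibSum L (1 ℕ.+ m)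
  incFibSum-recurrence L m = begin
    incFibSum (suc L) (3 ℕ.+ m)                     ≈⟨ sumTo-suc L (term (3 ℕ.+ m)) ⟩
    term (3 ℕ.+ m) 0 + sumTo L (λ i → term (3 ℕ.+ m) (suc i))
      ≈⟨ +-cong (term-0 (2 ℕ.+ m)) (sumTo-cong L (term-pascal m)) ⟩
    h * h ^ (suc m) + sumTo L (λ i → h * term (2 ℕ.+ m) (suc i) + term (1 ℕ.+ m) i)
      ≈⟨ +-congˡ (sumTo-distrib-+ L _ _) ⟩
    h * h ^ (suc m) + (sumTo L (λ i → h * term (2 ℕ.+ m) (suc i)) + incFibSum L (1 ℕ.+ m))
      ≈⟨ +-assoc _ _ _ ⟨
    (h * h ^ (suc m) + sumTo L (λ i → h * term (2 ℕ.+ m) (suc i))) + incFibSum L (1 ℕ.+ m)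
      ≈⟨ +-congʳ (+-congˡ (*-distribˡ-sumTo L h _)) ⟨
    (h * h ^ (suc m) + h * sumTo L (λ i → term (2 ℕ.+ m) (suc i))) + incFibSum L (1 ℕ.+ m)
      ≈⟨ +-congʳ (distribˡ h _ _) ⟨
    h * (h ^ (suc m) + sumTo L (λ i → term (2 ℕ.+ m) (suc i))) + incFibSum L (1 ℕ.+ m)
      ≈⟨ +-congʳ (*-congˡ (trans (sumTo-suc L (term (2 ℕ.+ m))) (+-congʳ (term-0 (suc m))))) ⟨
    h * incFibSum (suc L) (2 ℕ.+ m) + incFibSum L (1 ℕ.+ m) ∎

  incFibSum-fibRecurrence : ∀ l m →
    incFibSum l (3 ℕ.+ m) + term (1 ℕ.+ m) l ≈ h * incFibSum l (2 ℕ.+ m) + incFibSum l (1 ℕ.+ m)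
  incFibSum-fibRecurrence zero    m =
    +-congʳ (trans (term-0 (2 ℕ.+ m)) (*-congˡ (sym (term-0 (1 ℕ.+ m)))))
  incFibSum-fibRecurrence (suc L) m = trans (+-congʳ (incFibSum-recurrence L m)) (+-assoc _ _ _)

  incFibSum-1 : ∀ L → incFibSum L 1 ≈ 1#
  incFibSum-1 zero    = term-0 0
  incFibSum-1 (suc L) = trans (+-identityʳ _) (incFibSum-1 L)

  incFibSum-2 : ∀ L → incFibSum L 2 ≈ h
  incFibSum-2 zero    = trans (term-0 1) (*-identityʳ h)
  incFibSum-2 (suc L) =
    trans (+-congˡ (×-congˡ (k>n⇒nCk≡0 (s≤s (ℕₚ.≤-trans (ℕₚ.m∸n≤m 0 L) z≤n)))))
          (trans (+-identityʳ _) (incFibSum-2 L))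

  incFibSum≈Fib : ∀ L m → m ℕ.≤ suc (2 ℕ.* L) → incFibSum L (suc m) ≈ Fib h (suc m)
  incFibSum≈Fib L       zero          _             = incFibSum-1 L
  incFibSum≈Fib L       (suc zero)    _             =
    trans (incFibSum-2 L) (sym (trans (+-identityʳ _) (*-identityʳ h)))
  incFibSum≈Fib zero    (suc (suc m)) (s≤s ())
  incFibSum≈Fib (suc L) (suc (suc m)) (s≤s (s≤s m≤2L+1)) = trans (incFibSum-recurrence L m)
    (+-cong (*-congˡ (incFibSum≈Fib (suc L) (suc m) (ℕₚ.m≤n⇒m≤1+n (s≤s m≤2L+1))))
            (incFibSum≈Fib L m (≡.subst (m ℕ.≤_) (ℕₚ.+-suc L (L ℕ.+ 0)) m≤2L+1)))

  1-ht : Series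
  1-ht = const 1# ⊖ const h ⊛ tpow 1

  1-ht-t² : Series
  1-ht-t² = 1-ht ⊖ tpow 2

  1-ht-constantTerm : 1-ht 0 ≈ 1#
  1-ht-constantTerm = y-x≈y 1# (zeroʳ h)

  1-ht-t²-constantTerm : 1-ht-t² 0 ≈ 1#
  1-ht-t²-constantTerm = trans (y-x≈y _ refl) 1-ht-constantTerm

  -- the coefficients of 1/(1 - ht)^(j+1)
  negBinomial : ℕ → Series
  negBinomial j m = ((m ℕ.+ j) C j) × h ^ m

  1-ht-⊛ : ∀ f n → (1-ht ⊛ f) n ≈ f n - h * (tpow 1 ⊛ f) n
  1-ht-⊛ f n = begin
    (1-ht ⊛ f) n                                          ≈⟨ ⊛-distribʳ (const 1#) _ f n ⟩
    (const 1# ⊛ f) n + ((⊝ (const h ⊛ tpow 1)) ⊛ f) n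
      ≈⟨ +-cong (⊛-identityˡ f n) (-‿distribˡ-⊛ (const h ⊛ tpow 1) f n) ⟩
    f n - ((const h ⊛ tpow 1) ⊛ f) n
      ≈⟨ +-congˡ (-‿cong (trans (⊛-assoc (const h) (tpow 1) f n) (const-⊛ h (tpow 1 ⊛ f) n))) ⟩
    f n - h * (tpow 1 ⊛ f) n                              ∎

  ⊛-1-ht-0 : ∀ f → (f ⊛ 1-ht) 0 ≈ f 0
  ⊛-1-ht-0 f = trans (⊛-comm f 1-ht 0)
    (trans (1-ht-⊛ f 0) (y-x≈y (f 0) (trans (*-congˡ (tpow-⊛ 1 f 0)) (zeroʳ h))))

  ⊛-1-ht-suc : ∀ f m → (f ⊛ 1-ht) (suc m) ≈ f (suc m) - h * f m
  ⊛-1-ht-suc f m = trans (⊛-comm f 1-ht (suc m))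
    (trans (1-ht-⊛ f (suc m)) (+-congˡ (-‿cong (*-congˡ (tpow-⊛ 1 f (suc m))))))

  negBinomial-0-⊛-1-ht : negBinomial 0 ⊛ 1-ht ≋ const 1#
  negBinomial-0-⊛-1-ht zero    = trans (⊛-1-ht-0 (negBinomial 0)) (term-0 0)
  negBinomial-0-⊛-1-ht (suc m) = begin
    (negBinomial 0 ⊛ 1-ht) (suc m)       ≈⟨ ⊛-1-ht-suc (negBinomial 0) m ⟩
    (h * h ^ m + 0#) - h * (h ^ m + 0#)  ≈⟨ +-cong (+-identityʳ _) (-‿cong (*-congˡ (+-identityʳ _))) ⟩
    h * h ^ m - h * h ^ m                ≈⟨ -‿inverseʳ _ ⟩
    0#                                   ∎

  negBinomial-suc-⊛-1-ht : ∀ j → negBinomial (suc j) ⊛ 1-ht ≋ negBinomial j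
  negBinomial-suc-⊛-1-ht j zero    = trans (⊛-1-ht-0 (negBinomial (suc j)))
    (×-congˡ (≡.trans (nCn≡1 (suc j)) (≡.sym (nCn≡1 j))))
  negBinomial-suc-⊛-1-ht j (suc m) = begin
    (negBinomial (suc j) ⊛ 1-ht) (suc m)             ≈⟨ ⊛-1-ht-suc (negBinomial (suc j)) m ⟩
    negBinomial (suc j) (suc m) - h * negBinomial (suc j) m
      ≡⟨ ≡.cong (λ n → (suc n C suc j) × h ^ suc m - h * (n C suc j) × h ^ m) top ⟩
    (suc N C suc j) × h ^ suc m - h * (N C suc j) × h ^ m
      ≈⟨ +-congʳ (×-pascal N j (suc m) (λ ())) ⟩
    (h * (N C suc j) × h ^ m + (N C j) × h ^ suc m) - h * (N C suc j) × h ^ m ≈⟨ xyx⁻¹≈y _ _ ⟩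
    negBinomial j (suc m)                           ∎
    where
    N = suc (m ℕ.+ j)
    top : m ℕ.+ suc j ≡ N
    top = ℕₚ.+-suc m j

  negBinomial-⊛-1-ht^ : ∀ j → negBinomial j ⊛ (1-ht ⊛^ suc j) ≋ const 1#
  negBinomial-⊛-1-ht^ zero    =
    ≋.trans (⊛-congˡ (negBinomial 0) (⊛-identityʳ 1-ht)) negBinomial-0-⊛-1-ht
  negBinomial-⊛-1-ht^ (suc j) =
    ≋.trans (≋.sym (⊛-assoc (negBinomial (suc j)) 1-ht (1-ht ⊛^ suc j)))
    (≋.trans (⊛-congʳ (1-ht ⊛^ suc j) (negBinomial-suc-⊛-1-ht j))
             (negBinomial-⊛-1-ht^ j))

  term≡negBinomial : ∀ l m → term (suc (m ℕ.+ 2 ℕ.* l)) l ≡ negBinomial l m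
  term≡negBinomial l m = ≡.cong₂ (λ n e → (n C l) × h ^ e) (m+2*n∸n≡m+n m l)
    (≡.trans ([1+m]∸n∸1≡m∸n (m ℕ.+ 2 ℕ.* l) (2 ℕ.* l)) (ℕₚ.m+n∸n≡m m (2 ℕ.* l)))

  1-ht-t²-⊛ : ∀ f n → (1-ht-t² ⊛ f) n ≈ (f n - h * (tpow 1 ⊛ f) n) - (tpow 2 ⊛ f) n
  1-ht-t²-⊛ f n =
    trans (⊛-distribʳ 1-ht (⊝ tpow 2) f n) (+-cong (1-ht-⊛ f n) (-‿distribˡ-⊛ (tpow 2) f n))

  1-ht-t²-⊛-0 : ∀ f → (1-ht-t² ⊛ f) 0 ≈ f 0
  1-ht-t²-⊛-0 f = trans (1-ht-t²-⊛ f 0)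
    (trans (y-x≈y _ (tpow-⊛ 2 f 0)) (y-x≈y (f 0) (trans (*-congˡ (tpow-⊛ 1 f 0)) (zeroʳ h))))

  1-ht-t²-⊛-1 : ∀ f → (1-ht-t² ⊛ f) 1 ≈ f 1 - h * f 0
  1-ht-t²-⊛-1 f = trans (1-ht-t²-⊛ f 1)
    (trans (y-x≈y _ (tpow-⊛ 2 f 1)) (+-congˡ (-‿cong (*-congˡ (tpow-⊛ 1 f 1)))))

  1-ht-t²-⊛-2+ : ∀ f m → (1-ht-t² ⊛ f) (2 ℕ.+ m) ≈ (f (2 ℕ.+ m) - h * f (1 ℕ.+ m)) - f m
  1-ht-t²-⊛-2+ f m = trans (1-ht-t²-⊛ f (2 ℕ.+ m))
    (+-cong (+-congˡ (-‿cong (*-congˡ (tpow-⊛ 1 f (2 ℕ.+ m))))) (-‿cong (tpow-⊛ 2 f (2 ℕ.+ m))))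

  x+y≈u+v⇒x-u-v≈-y : ∀ {x y u v} → x + y ≈ u + v → (x - u) - v ≈ - y
  x+y≈u+v⇒x-u-v≈-y {x} {y} {u} {v} x+y≈u+v = inverseˡ-unique _ _ (begin
    ((x - u) - v) + y ≈⟨ xy∙z≈xz∙y _ _ _ ⟩
    ((x - u) + y) - v ≈⟨ +-congʳ (xy∙z≈xz∙y _ _ _) ⟩
    ((x + y) - u) - v ≈⟨ +-congʳ (+-congʳ x+y≈u+v) ⟩
    ((u + v) - u) - v ≈⟨ +-congʳ (xyx⁻¹≈y u v) ⟩
    v - v             ≈⟨ -‿inverseʳ v ⟩
    0#                ∎)

  module _ (l : ℕ) where
    private
      k : ℕ
      k = suc (2 ℕ.* l)

      B : Carrier
      B = Fib h (suc k) - h * Fib h k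

      P : Series
      P = 1-ht ⊛^ suc l

    -- indexed by m + 2l so that shifted (2 + m) is incFibSum l (3 + (m + 2l)) definitionally
    shifted : Series
    shifted m = incFibSum l (suc (m ℕ.+ 2 ℕ.* l))

    numerator : Series
    numerator = const (Fib h k) ⊕ const B ⊛ tpow 1 ⊖ tpow 2 ⊘ P

    IncFib≋tpow⊛shifted : IncFib h l ≋ tpow k ⊛ shifted
    IncFib≋tpow⊛shifted n = trans (cutoff (n <ᵇ k) ≡.refl) (sym (tpow-⊛ k shifted n))
      where
      cutoff : ∀ b → (n <ᵇ k) ≡ b →
               (if b then 0# else incFibSum l n) ≈ (if b then 0# else shifted (n ∸ k))
      cutoff true  _     = refl
      cutoff false n≮ᵇk = reflexive (≡.cong (incFibSum l)
        (≡.sym (≡.trans (≡.sym (ℕₚ.+-suc (n ∸ k) (2 ℕ.* l))) (ℕₚ.m∸n+n≡m k≤n))))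
        where
        k≤n : k ℕ.≤ n
        k≤n = ℕₚ.≮⇒≥ (λ n<k → ≡.subst T n≮ᵇk (ℕₚ.<⇒<ᵇ n<k))

    inv-1-ht^≋negBinomial : inv P ≋ negBinomial l
    inv-1-ht^≋negBinomial = ≋.sym (≋.trans
      (⊘-unique (⊛^-constantTerm 1-ht-constantTerm (suc l)) (negBinomial-⊛-1-ht^ l))
      (⊛-identityˡ _))

    numerator-0 : numerator 0 ≈ Fib h k
    numerator-0 = trans (y-x≈y _ (tpow-⊛ 2 (inv P) 0)) (trans (+-congˡ (zeroʳ B)) (+-identityʳ _))

    numerator-1 : numerator 1 ≈ B
    numerator-1 = trans (y-x≈y _ (tpow-⊛ 2 (inv P) 1))
      (trans (+-identityˡ _) (trans (const-⊛ B (tpow 1) 1) (*-identityʳ B)))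

    numerator-2+ : ∀ m → numerator (2 ℕ.+ m) ≈ - negBinomial l m
    numerator-2+ m = begin
      (0# + (const B ⊛ tpow 1) (2 ℕ.+ m)) - (tpow 2 ⊛ inv P) (2 ℕ.+ m)
        ≈⟨ +-cong (trans (+-identityˡ _) (const-⊛ B (tpow 1) (2 ℕ.+ m)))
                  (-‿cong (tpow-⊛ 2 (inv P) (2 ℕ.+ m))) ⟩
      B * 0# - inv P m             ≈⟨ +-cong (zeroʳ B) (-‿cong (inv-1-ht^≋negBinomial m)) ⟩
      0# - negBinomial l m         ≈⟨ +-identityˡ _ ⟩
      - negBinomial l m            ∎

    1-ht-t²⊛shifted≋numerator : 1-ht-t² ⊛ shifted ≋ numerator
    1-ht-t²⊛shifted≋numerator zero          = begin
      (1-ht-t² ⊛ shifted) 0        ≈⟨ 1-ht-t²-⊛-0 shifted ⟩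
      shifted 0                    ≈⟨ incFibSum≈Fib l (2 ℕ.* l) (ℕₚ.n≤1+n _) ⟩
      Fib h k                      ≈⟨ numerator-0 ⟨
      numerator 0                  ∎
    1-ht-t²⊛shifted≋numerator (suc zero)    = begin
      (1-ht-t² ⊛ shifted) 1        ≈⟨ 1-ht-t²-⊛-1 shifted ⟩
      shifted 1 - h * shifted 0
        ≈⟨ +-cong (incFibSum≈Fib l k ℕₚ.≤-refl)
                  (-‿cong (*-congˡ (incFibSum≈Fib l (2 ℕ.* l) (ℕₚ.n≤1+n _)))) ⟩
      B                            ≈⟨ numerator-1 ⟨
      numerator 1                  ∎
    1-ht-t²⊛shifted≋numerator (suc (suc m)) = begin
      (1-ht-t² ⊛ shifted) (2 ℕ.+ m) ≈⟨ 1-ht-t²-⊛-2+ shifted m ⟩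
      (shifted (2 ℕ.+ m) - h * shifted (1 ℕ.+ m)) - shifted m
        ≈⟨ x+y≈u+v⇒x-u-v≈-y (incFibSum-fibRecurrence l (m ℕ.+ 2 ℕ.* l)) ⟩
      - term (suc (m ℕ.+ 2 ℕ.* l)) l ≈⟨ -‿cong (reflexive (term≡negBinomial l m)) ⟩
      - negBinomial l m             ≈⟨ numerator-2+ m ⟨
      numerator (2 ℕ.+ m)           ∎

    incFib-generatingFunction : IncFib h l ≋ (tpow k ⊛ numerator) ⊘ 1-ht-t²
    incFib-generatingFunction =
      ≋.trans IncFib≋tpow⊛shifted
      (≋.trans (⊛-congˡ (tpow k) (⊘-unique 1-ht-t²-constantTerm shifted⊛1-ht-t²≋numerator))
               (≋.sym (⊛-assoc (tpow k) numerator (inv 1-ht-t²))))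
      where
      shifted⊛1-ht-t²≋numerator : shifted ⊛ 1-ht-t² ≋ numerator
      shifted⊛1-ht-t²≋numerator = ≋.trans (⊛-comm shifted 1-ht-t²) 1-ht-t²⊛shifted≋numerator

theorem17 : ∀ {c ℓ} (R : CommutativeRing c ℓ) (h : CommutativeRing.Carrier R) (l : ℕ) →
    let open FPS R in
    IncFib h l
      ≋ (tpow (suc (2 ℕ.* l))
           ⊛ (const (Fib h (suc (2 ℕ.* l)))
              ⊕ const (Fib h (suc (suc (2 ℕ.* l))) - h * Fib h (suc (2 ℕ.* l))) ⊛ tpow 1
              ⊖ tpow 2 ⊘ ((const 1# ⊖ const h ⊛ tpow 1) ⊛^ suc l)))
        ⊘ (const 1# ⊖ const h ⊛ tpow 1 ⊖ tpow 2)
theorem17 R h l = IncompleteFibonacci.incFib-generatingFunction R h l
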